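{- The syntactic categories $\mathrm{Syn}(\mathsf{Glob})$ and $\mathrm{Syn}(\mathsf{Glob}_{\mathbf 1})$ are equivalent.
   Context: Raw contexts are finite lists $(x_1:A_1,\dots,x_n:A_n)$ of distinct variables with types; raw substitutions are lists $\langle x_1\mapsto t_1,\dots\rangle$; judgments $\Gamma\vdash$, $\Gamma\vdash A$, $\Gamma\vdash t:A$, $\Delta\vdash\sigma:\Gamma$. Common rules: $\varnothing\vdash$; from $\Gamma\vdash A$ with $x$ fresh infer $(\Gamma,x:A)\vdash$; from $\Gamma\vdash$ and $(x:A)\in\Gamma$ infer $\Gamma\vdash x:A$; from $\Delta\vdash$ infer $\Delta\vdash\langle\rangle:\varnothing$; from $\Delta\vdash\sigma:\Gamma$, $(\Gamma,x:A)\vdash$, $\Delta\vdash t:A[\sigma]$ infer $\Delta\vdash\langle\sigma,x\mapsto t\rangle:(\Gamma,x:A)$. Substitution on variables: $x[\langle\rangle]=x$, $x[\langle\sigma,y\mapsto t\rangle]=t$ if $x=y$ else $x[\sigma]$; composition $\langle\sigma,x\mapsto t\rangle\circ\delta=\langle\sigma\circ\delta,x\mapsto t[\delta]\rangle$, $\langle\rangle\circ\delta=\langle\rangle$. $\mathrm{Syn}(T)$: derivable contexts as objects, derivable substitutions $\Delta\vdash\sigma:\Gamma$ (up to definitional equality if any) as morphisms $\Delta\to\Gamma$. $\mathsf{Glob}$: types $\star$ and $\mathrm{Hom}_Atu$ ($\star[\sigma]=\star$, $(\mathrm{Hom}_Atu)[\sigma]=\mathrm{Hom}_{A[\sigma]}t[\sigma]u[\sigma]$);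 only variables as terms; rules: $\Gamma\vdash$ gives $\Gamma\vdash\star$; $\Gamma\vdash t:A$, $\Gamma\vdash u:A$ give $\Gamma\vdash\mathrm{Hom}_Atu$. $\mathsf{Glob}_{\mathbf 1}$: types $\mathbf 1$ and $\mathrm{Hom}_Atu$; terms: variables and the constant $()$; $\mathbf 1[\sigma]=\mathbf 1$, $()[\sigma]=()$; rules: $\Gamma\vdash$ gives $\Gamma\vdash\mathbf 1$ and $\Gamma\vdash():\mathbf 1$; $\Gamma\vdash A$, $\Gamma\vdash t:A$, $\Gamma\vdash u:A$ give $\Gamma\vdash\mathrm{Hom}_Atu$; definitional equality: $\Gamma\vdash t:A$ and $A\equiv B$ give $\Gamma\vdash t:B$; $\Gamma\vdash t:\mathbf 1$ gives $t\equiv()$. In $\mathsf{Glob}_{\mathbf 1}$, $\star$ denotes $\mathrm{Hom}_{\mathbf 1}()()$, so $\mathsf{Glob}$ expressions are read as $\mathsf{Glob}_{\mathbf 1}$ expressions. -}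

module Defs where

open import Data.Nat using (ℕ; _≡ᵇ_)
open import Data.Bool using (if_then_else_)
open import Data.Product using (Σ; _×_; _,_; proj₁; proj₂)
open import Data.Unit using (⊤)
open import Relation.Binary.PropositionalEquality using (_≡_; _≢_)
open import Level using (Level; _⊔_; suc)

-- A type theory T supplies raw contexts, raw substitutions, the
-- judgments  Γ ⊢  and  Δ ⊢ σ : Γ,  definitional equality of
-- substitutions  Δ ⊢ σ ≡ τ : Γ  (syntactic equality when the theory has
-- no definitional equality), identity substitutions and composition.

record TypeTheory : Set₁ where
  field
    Ctx    : Set
    Sub    : Set
    WfCtx  : Ctx → Set
    WfSub  : Ctx → Sub → Ctx → Set
    SubEq  : Ctx → Sub → Sub → Ctx → Set
    idS    : Ctx → Sub
    _∘S_   : Sub → Sub → Sub     -- σ ∘S δ : Θ → Γ  for  σ : Δ → Γ, δ : Θ → Δ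

module Syn (T : TypeTheory) where
  open TypeTheory T

  Obj : Set
  Obj = Σ Ctx WfCtx

  ctx : Obj → Ctx
  ctx = proj₁

  Hom : Obj → Obj → Set
  Hom Δ Γ = Σ Sub (λ σ → WfSub (ctx Δ) σ (ctx Γ))

  sub : ∀ {Δ Γ} → Hom Δ Γ → Sub
  sub = proj₁

  _≈[_,_]_ : Sub → Obj → Obj → Sub → Set
  σ ≈[ Δ , Γ ] τ = SubEq (ctx Δ) σ τ (ctx Γ)

record FunData (S T : TypeTheory) : Set where
  open Syn
  field
    F₀ : Obj S → Obj T
    F₁ : ∀ {Δ Γ} → Hom S Δ Γ → Hom T (F₀ Δ) (F₀ Γ)

idFun : (S : TypeTheory) → FunData S S
idFun S = record { F₀ = λ Γ → Γ ; F₁ = λ f → f }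

_∘F_ : ∀ {R S T} → FunData S T → FunData R S → FunData R T
G ∘F F = record { F₀ = λ Γ → G₀ (F₀ Γ) ; F₁ = λ f → G₁ (F₁ f) }
  where
  open FunData F
  open FunData G renaming (F₀ to G₀; F₁ to G₁)

-- Functor laws.  Identities and composites in Syn(S) are the raw
-- identity substitution and raw composition; they are quantified
-- together with a derivation witnessing that they are morphisms.
record IsFunctor {S T : TypeTheory} (F : FunData S T) : Set where
  open Syn
  open FunData F
  open TypeTheory
  field
    F-resp : ∀ {Δ Γ} (f g : Hom S Δ Γ) →
             _≈[_,_]_ S (proj₁ f) Δ Γ (proj₁ g) →
             _≈[_,_]_ T (proj₁ (F₁ {Δ} {Γ} f)) (F₀ Δ) (F₀ Γ) (proj₁ (F₁ {Δ} {Γ} g))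
    F-id   : ∀ (Γ : Obj S) (d : WfSub S (ctx S Γ) (idS S (ctx S Γ)) (ctx S Γ)) →
             _≈[_,_]_ T (proj₁ (F₁ {Γ} {Γ} (idS S (ctx S Γ) , d))) (F₀ Γ) (F₀ Γ)
                        (idS T (ctx T (F₀ Γ)))
    F-comp : ∀ {Θ Δ Γ} (f : Hom S Δ Γ) (g : Hom S Θ Δ)
             (d : WfSub S (ctx S Θ) (_∘S_ S (proj₁ f) (proj₁ g)) (ctx S Γ)) →
             _≈[_,_]_ T (proj₁ (F₁ {Θ} {Γ} (_∘S_ S (proj₁ f) (proj₁ g) , d))) (F₀ Θ) (F₀ Γ)
                        (_∘S_ T (proj₁ (F₁ {Δ} {Γ} f)) (proj₁ (F₁ {Θ} {Δ} g)))

record NatIso {S T : TypeTheory} (F G : FunData S T) : Set where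
  open Syn
  open TypeTheory
  open FunData F
  open FunData G renaming (F₀ to G₀; F₁ to G₁)
  field
    η     : ∀ Γ → Hom T (F₀ Γ) (G₀ Γ)
    η⁻¹   : ∀ Γ → Hom T (G₀ Γ) (F₀ Γ)
    iso₁  : ∀ Γ → _≈[_,_]_ T (_∘S_ T (proj₁ (η⁻¹ Γ)) (proj₁ (η Γ))) (F₀ Γ) (F₀ Γ)
                               (idS T (ctx T (F₀ Γ)))
    iso₂  : ∀ Γ → _≈[_,_]_ T (_∘S_ T (proj₁ (η Γ)) (proj₁ (η⁻¹ Γ))) (G₀ Γ) (G₀ Γ)
                               (idS T (ctx T (G₀ Γ)))
    natural : ∀ {Δ Γ} (f : Hom S Δ Γ) →
              _≈[_,_]_ T (_∘S_ T (proj₁ (G₁ {Δ} {Γ} f)) (proj₁ (η Δ))) (F₀ Δ) (G₀ Γ)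
                         (_∘S_ T (proj₁ (η Γ)) (proj₁ (F₁ {Δ} {Γ} f)))

record SynEquivalence (S T : TypeTheory) : Set where
  field
    F       : FunData S T
    G       : FunData T S
    F-isFun : IsFunctor F
    G-isFun : IsFunctor G
    unit    : NatIso (idFun S) (G ∘F F)
    counit  : NatIso (F ∘F G) (idFun T)

Var : Set
Var = ℕ

module Glob where

  data Ty : Set where
    ⋆   : Ty
    Hom : Ty → Var → Var → Ty

  data Ctx : Set where
    ∅     : Ctx
    _▸_∶_ : Ctx → Var → Ty → Ctx

  data Sub : Set where
    ⟨⟩      : Sub
    _,_↦_   : Sub → Var → Var → Sub

  Fresh : Var → Ctx → Set
  Fresh x ∅ = ⊤
  Fresh x (Γ ▸ y ∶ A) = (x ≢ y) × Fresh x Γ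

  data _∶_∈_ : Var → Ty → Ctx → Set where
    here  : ∀ {Γ x A} → x ∶ A ∈ (Γ ▸ x ∶ A)
    there : ∀ {Γ x A y B} → x ∶ A ∈ Γ → x ∶ A ∈ (Γ ▸ y ∶ B)

  _[_]v : Var → Sub → Var
  x [ ⟨⟩ ]v = x
  x [ σ , y ↦ t ]v = if x ≡ᵇ y then t else x [ σ ]v

  _[_]T : Ty → Sub → Ty
  ⋆ [ σ ]T = ⋆
  Hom A t u [ σ ]T = Hom (A [ σ ]T) (t [ σ ]v) (u [ σ ]v)

  _∘_ : Sub → Sub → Sub
  ⟨⟩ ∘ δ = ⟨⟩
  (σ , x ↦ t) ∘ δ = (σ ∘ δ) , x ↦ (t [ δ ]v)

  idS : Ctx → Sub
  idS ∅ = ⟨⟩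
  idS (Γ ▸ x ∶ A) = idS Γ , x ↦ x

  data _⊢ : Ctx → Set
  data _⊢ty_ : Ctx → Ty → Set
  data _⊢_∶_ : Ctx → Var → Ty → Set

  data _⊢ where
    ∅-wf : ∅ ⊢
    ▸-wf : ∀ {Γ x A} → Γ ⊢ty A → Fresh x Γ → (Γ ▸ x ∶ A) ⊢

  data _⊢ty_ where
    ⋆-wf   : ∀ {Γ} → Γ ⊢ → Γ ⊢ty ⋆
    Hom-wf : ∀ {Γ A t u} → Γ ⊢ t ∶ A → Γ ⊢ u ∶ A → Γ ⊢ty Hom A t u

  data _⊢_∶_ where
    var : ∀ {Γ x A} → Γ ⊢ → x ∶ A ∈ Γ → Γ ⊢ x ∶ A

  data _⊢s_∶_ : Ctx → Sub → Ctx → Set where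
    ⟨⟩-wf : ∀ {Δ} → Δ ⊢ → Δ ⊢s ⟨⟩ ∶ ∅
    ext-wf : ∀ {Δ Γ σ x A t} → Δ ⊢s σ ∶ Γ → (Γ ▸ x ∶ A) ⊢ →
             Δ ⊢ t ∶ (A [ σ ]T) → Δ ⊢s (σ , x ↦ t) ∶ (Γ ▸ x ∶ A)

  theory : TypeTheory
  theory = record
    { Ctx   = Ctx
    ; Sub   = Sub
    ; WfCtx = _⊢
    ; WfSub = _⊢s_∶_
    ; SubEq = λ Δ σ τ Γ → σ ≡ τ      -- no definitional equality in Glob
    ; idS   = idS
    ; _∘S_  = _∘_
    }

module Glob₁ where

  data Tm : Set where
    var : Var → Tm
    ⋆tt : Tm          -- the constant ()

  data Ty : Set where
    𝟏   : Ty
    Hom : Ty → Tm → Tm → Ty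

  ⋆ : Ty
  ⋆ = Hom 𝟏 ⋆tt ⋆tt

  data Ctx : Set where
    ∅     : Ctx
    _▸_∶_ : Ctx → Var → Ty → Ctx

  data Sub : Set where
    ⟨⟩      : Sub
    _,_↦_   : Sub → Var → Tm → Sub

  Fresh : Var → Ctx → Set
  Fresh x ∅ = ⊤
  Fresh x (Γ ▸ y ∶ A) = (x ≢ y) × Fresh x Γ

  data _∶_∈_ : Var → Ty → Ctx → Set where
    here  : ∀ {Γ x A} → x ∶ A ∈ (Γ ▸ x ∶ A)
    there : ∀ {Γ x A y B} → x ∶ A ∈ Γ → x ∶ A ∈ (Γ ▸ y ∶ B)

  _[_]v : Var → Sub → Tm
  x [ ⟨⟩ ]v = var x
  x [ σ , y ↦ t ]v = if x ≡ᵇ y then t else x [ σ ]v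

  _[_]t : Tm → Sub → Tm
  var x [ σ ]t = x [ σ ]v
  ⋆tt [ σ ]t = ⋆tt

  _[_]T : Ty → Sub → Ty
  𝟏 [ σ ]T = 𝟏
  Hom A t u [ σ ]T = Hom (A [ σ ]T) (t [ σ ]t) (u [ σ ]t)

  _∘_ : Sub → Sub → Sub
  ⟨⟩ ∘ δ = ⟨⟩
  (σ , x ↦ t) ∘ δ = (σ ∘ δ) , x ↦ (t [ δ ]t)

  idS : Ctx → Sub
  idS ∅ = ⟨⟩
  idS (Γ ▸ x ∶ A) = idS Γ , x ↦ var x

  data _⊢ : Ctx → Set
  data _⊢ty_ : Ctx → Ty → Set
  data _⊢_∶_ : Ctx → Tm → Ty → Set
  data _⊢_≡ty_ : Ctx → Ty → Ty → Set
  data _⊢_≡tm_∶_ : Ctx → Tm → Tm → Ty → Set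

  data _⊢ where
    ∅-wf : ∅ ⊢
    ▸-wf : ∀ {Γ x A} → Γ ⊢ty A → Fresh x Γ → (Γ ▸ x ∶ A) ⊢

  data _⊢ty_ where
    𝟏-wf   : ∀ {Γ} → Γ ⊢ → Γ ⊢ty 𝟏
    Hom-wf : ∀ {Γ A t u} → Γ ⊢ty A → Γ ⊢ t ∶ A → Γ ⊢ u ∶ A → Γ ⊢ty Hom A t u

  data _⊢_∶_ where
    var  : ∀ {Γ x A} → Γ ⊢ → x ∶ A ∈ Γ → Γ ⊢ var x ∶ A
    tt-wf : ∀ {Γ} → Γ ⊢ → Γ ⊢ ⋆tt ∶ 𝟏
    conv : ∀ {Γ t A B} → Γ ⊢ t ∶ A → Γ ⊢ A ≡ty B → Γ ⊢ t ∶ B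

  data _⊢_≡ty_ where
    ty-refl  : ∀ {Γ A} → Γ ⊢ty A → Γ ⊢ A ≡ty A
    ty-sym   : ∀ {Γ A B} → Γ ⊢ A ≡ty B → Γ ⊢ B ≡ty A
    ty-trans : ∀ {Γ A B C} → Γ ⊢ A ≡ty B → Γ ⊢ B ≡ty C → Γ ⊢ A ≡ty C
    Hom-cong : ∀ {Γ A A' t t' u u'} → Γ ⊢ A ≡ty A' →
               Γ ⊢ t ≡tm t' ∶ A → Γ ⊢ u ≡tm u' ∶ A →
               Γ ⊢ Hom A t u ≡ty Hom A' t' u'

  data _⊢_≡tm_∶_ where
    tm-refl  : ∀ {Γ t A} → Γ ⊢ t ∶ A → Γ ⊢ t ≡tm t ∶ A
    tm-sym   : ∀ {Γ t u A} → Γ ⊢ t ≡tm u ∶ A → Γ ⊢ u ≡tm t ∶ A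
    tm-trans : ∀ {Γ t u v A} → Γ ⊢ t ≡tm u ∶ A → Γ ⊢ u ≡tm v ∶ A → Γ ⊢ t ≡tm v ∶ A
    tm-conv  : ∀ {Γ t u A B} → Γ ⊢ t ≡tm u ∶ A → Γ ⊢ A ≡ty B → Γ ⊢ t ≡tm u ∶ B
    𝟏-η      : ∀ {Γ t} → Γ ⊢ t ∶ 𝟏 → Γ ⊢ t ≡tm ⋆tt ∶ 𝟏

  data _⊢s_∶_ : Ctx → Sub → Ctx → Set where
    ⟨⟩-wf : ∀ {Δ} → Δ ⊢ → Δ ⊢s ⟨⟩ ∶ ∅
    ext-wf : ∀ {Δ Γ σ x A t} → Δ ⊢s σ ∶ Γ → (Γ ▸ x ∶ A) ⊢ →
             Δ ⊢ t ∶ (A [ σ ]T) → Δ ⊢s (σ , x ↦ t) ∶ (Γ ▸ x ∶ A)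

  data _⊢s_≡s_∶_ : Ctx → Sub → Sub → Ctx → Set where
    ⟨⟩-eq  : ∀ {Δ} → Δ ⊢ → Δ ⊢s ⟨⟩ ≡s ⟨⟩ ∶ ∅
    ext-eq : ∀ {Δ Γ σ τ x A t u} → Δ ⊢s σ ≡s τ ∶ Γ → (Γ ▸ x ∶ A) ⊢ →
             Δ ⊢ t ≡tm u ∶ (A [ σ ]T) →
             Δ ⊢s (σ , x ↦ t) ≡s (τ , x ↦ u) ∶ (Γ ▸ x ∶ A)

  theory : TypeTheory
  theory = record
    { Ctx   = Ctx
    ; Sub   = Sub
    ; WfCtx = _⊢
    ; WfSub = _⊢s_∶_
    ; SubEq = _⊢s_≡s_∶_
    ; idS   = idS
    ; _∘S_  = _∘_
    }

{-# OPTIONS --safe #-}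
module Submission where

-- Reading ⋆ as Hom_𝟏 () () includes Glob into Glob₁.  Conversely, erasing
-- every variable of type 𝟏 and reading Hom_𝟏 t u back as ⋆ maps Glob₁ to
-- Glob.  The only definitional equalities of Glob₁ are between terms of
-- type 𝟏, so a type is determined up to definitional equality by its
-- erasure (its shape), and a term of a Hom type is a variable, equal only
-- to itself.  This makes erasure a functor, and erasure after inclusion is
-- the identity on the nose.  For the other composite, the substitution
-- sending each 𝟏-variable of Γ to () and every other variable to itself is
-- a morphism from the erased Γ back to Γ; its inverse forgets the
-- 𝟏-variables, and the two composites differ from identities only in
-- components of type 𝟏, where 𝟏-η identifies them.

open import Defs
open import Data.Nat using (_≡ᵇ_)
open import Data.Nat.Properties using (≡ᵇ⇒≡; ≡⇒≡ᵇ)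
open import Data.Bool using (true; false)
open import Data.Bool.Properties using (T-≡; ¬-not)
open import Data.Maybe using (Maybe; just; nothing)
open import Data.Maybe.Properties using (just-injective)
open import Data.Product using (_×_; _,_; proj₁)
open import Data.Sum using (_⊎_; inj₁; inj₂)
open import Data.Unit using (⊤; tt)
open import Data.Empty using (⊥; ⊥-elim)
open import Function using (_∘′_; Equivalence)
open import Relation.Binary.PropositionalEquality

≡ᵇ-refl : ∀ x → (x ≡ᵇ x) ≡ true
≡ᵇ-refl x = Equivalence.to T-≡ (≡⇒≡ᵇ x x refl)

≡ᵇ-≢ : ∀ {x y} → x ≢ y → (x ≡ᵇ y) ≡ false
≡ᵇ-≢ {x} {y} x≢y = ¬-not (x≢y ∘′ ≡ᵇ⇒≡ x y ∘′ Equivalence.from T-≡)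

≡ᵇ-true⇒≡ : ∀ {x y} → (x ≡ᵇ y) ≡ true → x ≡ y
≡ᵇ-true⇒≡ {x} {y} eq = ≡ᵇ⇒≡ x y (Equivalence.from T-≡ eq)

module G where
  open Glob public

  []v-idS : ∀ Γ x → x [ idS Γ ]v ≡ x
  []v-idS ∅ x = refl
  []v-idS (Γ ▸ y ∶ A) x with x ≡ᵇ y in eq
  ... | true  = sym (≡ᵇ-true⇒≡ eq)
  ... | false = []v-idS Γ x

  []T-idS : ∀ Γ A → A [ idS Γ ]T ≡ A
  []T-idS Γ ⋆ = refl
  []T-idS Γ (Hom A t u) rewrite []T-idS Γ A | []v-idS Γ t | []v-idS Γ u = refl

  ∘-identityʳ : ∀ σ Γ → σ ∘ idS Γ ≡ σ
  ∘-identityʳ ⟨⟩ Γ = refl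
  ∘-identityʳ (σ , x ↦ t) Γ = cong₂ (_, x ↦_) (∘-identityʳ σ Γ) ([]v-idS Γ t)

  idS-∘-fresh : ∀ {x Γ σ t} → Fresh x Γ → idS Γ ∘ (σ , x ↦ t) ≡ idS Γ ∘ σ
  idS-∘-fresh {Γ = ∅} _ = refl
  idS-∘-fresh {x} {Γ ▸ y ∶ A} {σ} (x≢y , fr) rewrite ≡ᵇ-≢ (x≢y ∘′ sym) =
    cong (_, y ↦ (y [ σ ]v)) (idS-∘-fresh fr)

  ∘-identityˡ : ∀ {Δ σ Γ} → Δ ⊢s σ ∶ Γ → idS Γ ∘ σ ≡ σ
  ∘-identityˡ (⟨⟩-wf _) = refl
  ∘-identityˡ (ext-wf {σ = σ} {x = x} {t = t} d (▸-wf _ fr) _)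
    rewrite idS-∘-fresh {σ = σ} {t = t} fr | ≡ᵇ-refl x = cong (_, x ↦ t) (∘-identityˡ d)

  ⊢ty⇒⊢ : ∀ {Γ A} → Γ ⊢ty A → Γ ⊢
  ⊢ty⇒⊢ (⋆-wf w) = w
  ⊢ty⇒⊢ (Hom-wf (var w _) _) = w

  wk-⊢tm : ∀ {Γ x B y A} → Γ ⊢ y ∶ A → (Γ ▸ x ∶ B) ⊢ → (Γ ▸ x ∶ B) ⊢ y ∶ A
  wk-⊢tm (var _ m) w = var w (there m)

  wk-⊢s : ∀ {Δ Γ σ x B} → Δ ⊢s σ ∶ Γ → (Δ ▸ x ∶ B) ⊢ → (Δ ▸ x ∶ B) ⊢s σ ∶ Γ
  wk-⊢s (⟨⟩-wf _) w = ⟨⟩-wf w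
  wk-⊢s (ext-wf d w′ t) w = ext-wf (wk-⊢s d w) w′ (wk-⊢tm t w)

  idS-wf : ∀ {Γ} → Γ ⊢ → Γ ⊢s idS Γ ∶ Γ
  idS-wf ∅-wf = ⟨⟩-wf ∅-wf
  idS-wf {Γ ▸ x ∶ A} w@(▸-wf a _) =
    ext-wf (wk-⊢s (idS-wf (⊢ty⇒⊢ a)) w) w
      (subst (λ B → (Γ ▸ x ∶ A) ⊢ x ∶ B) (sym ([]T-idS Γ A)) (var w here))

open Glob₁

[]v-idS : ∀ Γ x → x [ idS Γ ]v ≡ var x
[]v-idS ∅ x = refl
[]v-idS (Γ ▸ y ∶ A) x with x ≡ᵇ y in eq
... | true  = cong var (sym (≡ᵇ-true⇒≡ eq))
... | false = []v-idS Γ x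

[]t-idS : ∀ Γ t → t [ idS Γ ]t ≡ t
[]t-idS Γ (var x) = []v-idS Γ x
[]t-idS Γ ⋆tt = refl

[]T-idS : ∀ Γ A → A [ idS Γ ]T ≡ A
[]T-idS Γ 𝟏 = refl
[]T-idS Γ (Hom A t u) rewrite []T-idS Γ A | []t-idS Γ t | []t-idS Γ u = refl

∈-fresh⇒≢ : ∀ {Γ x y A} → Fresh y Γ → x ∶ A ∈ Γ → x ≢ y
∈-fresh⇒≢ (y≢x , _) here = y≢x ∘′ sym
∈-fresh⇒≢ (_ , fr) (there m) = ∈-fresh⇒≢ fr m

⊢ty⇒⊢ : ∀ {Γ A} → Γ ⊢ty A → Γ ⊢
⊢ty⇒⊢ (𝟏-wf w) = w
⊢ty⇒⊢ (Hom-wf a _ _) = ⊢ty⇒⊢ a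

⊢tm⇒⊢ : ∀ {Γ t A} → Γ ⊢ t ∶ A → Γ ⊢
⊢tm⇒⊢ (var w _) = w
⊢tm⇒⊢ (tt-wf w) = w
⊢tm⇒⊢ (conv d _) = ⊢tm⇒⊢ d

wk-⊢ty : ∀ {Γ x B A} → Γ ⊢ty A → (Γ ▸ x ∶ B) ⊢ → (Γ ▸ x ∶ B) ⊢ty A
wk-⊢tm : ∀ {Γ x B t A} → Γ ⊢ t ∶ A → (Γ ▸ x ∶ B) ⊢ → (Γ ▸ x ∶ B) ⊢ t ∶ A
wk-≡ty : ∀ {Γ x B A A′} → Γ ⊢ A ≡ty A′ → (Γ ▸ x ∶ B) ⊢ → (Γ ▸ x ∶ B) ⊢ A ≡ty A′
wk-≡tm : ∀ {Γ x B t u A} → Γ ⊢ t ≡tm u ∶ A → (Γ ▸ x ∶ B) ⊢ → (Γ ▸ x ∶ B) ⊢ t ≡tm u ∶ A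
wk-⊢ty (𝟏-wf _) w = 𝟏-wf w
wk-⊢ty (Hom-wf a t u) w = Hom-wf (wk-⊢ty a w) (wk-⊢tm t w) (wk-⊢tm u w)
wk-⊢tm (var _ m) w = var w (there m)
wk-⊢tm (tt-wf _) w = tt-wf w
wk-⊢tm (conv d e) w = conv (wk-⊢tm d w) (wk-≡ty e w)
wk-≡ty (ty-refl a) w = ty-refl (wk-⊢ty a w)
wk-≡ty (ty-sym e) w = ty-sym (wk-≡ty e w)
wk-≡ty (ty-trans e f) w = ty-trans (wk-≡ty e w) (wk-≡ty f w)
wk-≡ty (Hom-cong e f g) w = Hom-cong (wk-≡ty e w) (wk-≡tm f w) (wk-≡tm g w)
wk-≡tm (tm-refl d) w = tm-refl (wk-⊢tm d w)
wk-≡tm (tm-sym e) w = tm-sym (wk-≡tm e w)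
wk-≡tm (tm-trans e f) w = tm-trans (wk-≡tm e w) (wk-≡tm f w)
wk-≡tm (tm-conv e f) w = tm-conv (wk-≡tm e w) (wk-≡ty f w)
wk-≡tm (𝟏-η d) w = 𝟏-η (wk-⊢tm d w)

wk-⊢s : ∀ {Δ Γ σ x B} → Δ ⊢s σ ∶ Γ → (Δ ▸ x ∶ B) ⊢ → (Δ ▸ x ∶ B) ⊢s σ ∶ Γ
wk-⊢s (⟨⟩-wf _) w = ⟨⟩-wf w
wk-⊢s (ext-wf d w′ t) w = ext-wf (wk-⊢s d w) w′ (wk-⊢tm t w)

∈⇒⊢ty : ∀ {Γ x A} → Γ ⊢ → x ∶ A ∈ Γ → Γ ⊢ty A
∈⇒⊢ty w@(▸-wf b _) here = wk-⊢ty b w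
∈⇒⊢ty w@(▸-wf b _) (there m) = wk-⊢ty (∈⇒⊢ty (⊢ty⇒⊢ b) m) w

idS-wf : ∀ {Γ} → Γ ⊢ → Γ ⊢s idS Γ ∶ Γ
idS-wf ∅-wf = ⟨⟩-wf ∅-wf
idS-wf {Γ ▸ x ∶ A} w@(▸-wf a _) =
  ext-wf (wk-⊢s (idS-wf (⊢ty⇒⊢ a)) w) w
    (subst (λ B → (Γ ▸ x ∶ A) ⊢ var x ∶ B) (sym ([]T-idS Γ A)) (var w here))

≡s-refl : ∀ {Δ σ Γ} → Δ ⊢s σ ∶ Γ → Δ ⊢s σ ≡s σ ∶ Γ
≡s-refl (⟨⟩-wf w) = ⟨⟩-eq w
≡s-refl (ext-wf d w t) = ext-eq (≡s-refl d) w (tm-refl t)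

≡s-resp-≡ : ∀ {Δ σ σ′ τ τ′ Γ} → σ ≡ σ′ → τ ≡ τ′ → Δ ⊢s σ ≡s τ ∶ Γ → Δ ⊢s σ′ ≡s τ′ ∶ Γ
≡s-resp-≡ refl refl e = e

,↦-injective : ∀ {σ τ : G.Sub} {x y t u} → (σ G., x ↦ t) ≡ (τ G., y ↦ u) → σ ≡ τ × t ≡ u
,↦-injective refl = refl , refl

inclTy : G.Ty → Ty
inclTy G.⋆ = ⋆
inclTy (G.Hom A t u) = Hom (inclTy A) (var t) (var u)

inclCtx : G.Ctx → Ctx
inclCtx G.∅ = ∅
inclCtx (Γ G.▸ x ∶ A) = inclCtx Γ ▸ x ∶ inclTy A

inclSub : G.Sub → Sub
inclSub G.⟨⟩ = ⟨⟩
inclSub (σ G., x ↦ t) = inclSub σ , x ↦ var t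

-- Junk values: () erases to the variable 0, and 𝟏 to ⋆; neither occurs
-- where erasure is applied to well-typed syntax of a Hom type.
eraseTm : Tm → Var
eraseTm (var x) = x
eraseTm ⋆tt = 0

eraseTy : Ty → G.Ty
eraseTy 𝟏 = G.⋆
eraseTy (Hom 𝟏 _ _) = G.⋆
eraseTy (Hom (Hom A a b) t u) = G.Hom (eraseTy (Hom A a b)) (eraseTm t) (eraseTm u)

eraseCtx : Ctx → G.Ctx
eraseCtx ∅ = G.∅
eraseCtx (Γ ▸ x ∶ 𝟏) = eraseCtx Γ
eraseCtx (Γ ▸ x ∶ Hom A t u) = eraseCtx Γ G.▸ x ∶ eraseTy (Hom A t u)

eraseSub : Ctx → Sub → G.Sub
eraseSub ∅ σ = G.⟨⟩
eraseSub (Γ ▸ x ∶ A) ⟨⟩ = G.⟨⟩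
eraseSub (Γ ▸ x ∶ 𝟏) (σ , y ↦ t) = eraseSub Γ σ
eraseSub (Γ ▸ x ∶ Hom A a b) (σ , y ↦ t) = eraseSub Γ σ G., y ↦ eraseTm t

incl-[]v : ∀ σ x → x [ inclSub σ ]v ≡ var (x G.[ σ ]v)
incl-[]v G.⟨⟩ x = refl
incl-[]v (σ G., y ↦ t) x with x ≡ᵇ y
... | true  = refl
... | false = incl-[]v σ x

incl-[]T : ∀ A σ → inclTy (A G.[ σ ]T) ≡ inclTy A [ inclSub σ ]T
incl-[]T G.⋆ σ = refl
incl-[]T (G.Hom A t u) σ rewrite incl-[]T A σ | incl-[]v σ t | incl-[]v σ u = refl

incl-∘ : ∀ σ δ → inclSub (σ G.∘ δ) ≡ inclSub σ ∘ inclSub δ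
incl-∘ G.⟨⟩ δ = refl
incl-∘ (σ G., x ↦ t) δ = cong₂ (_, x ↦_) (incl-∘ σ δ) (sym (incl-[]v δ t))

incl-idS : ∀ Γ → inclSub (G.idS Γ) ≡ idS (inclCtx Γ)
incl-idS G.∅ = refl
incl-idS (Γ G.▸ x ∶ A) = cong (_, x ↦ var x) (incl-idS Γ)

incl-fresh : ∀ {x Γ} → G.Fresh x Γ → Fresh x (inclCtx Γ)
incl-fresh {Γ = G.∅} _ = tt
incl-fresh {Γ = Γ G.▸ y ∶ A} (x≢y , fr) = x≢y , incl-fresh fr

incl-∈ : ∀ {x A Γ} → x G.∶ A ∈ Γ → x ∶ inclTy A ∈ inclCtx Γ
incl-∈ G.here = here
incl-∈ (G.there m) = there (incl-∈ m)

incl-⊢ : ∀ {Γ} → Γ G.⊢ → inclCtx Γ ⊢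
incl-⊢ty : ∀ {Γ A} → Γ G.⊢ty A → inclCtx Γ ⊢ty inclTy A
incl-⊢tm : ∀ {Γ x A} → Γ G.⊢ x ∶ A → inclCtx Γ ⊢ var x ∶ inclTy A
incl-⊢ G.∅-wf = ∅-wf
incl-⊢ (G.▸-wf a fr) = ▸-wf (incl-⊢ty a) (incl-fresh fr)
incl-⊢ty (G.⋆-wf w) = Hom-wf (𝟏-wf (incl-⊢ w)) (tt-wf (incl-⊢ w)) (tt-wf (incl-⊢ w))
incl-⊢ty (G.Hom-wf t@(G.var w m) u) =
  Hom-wf (∈⇒⊢ty (incl-⊢ w) (incl-∈ m)) (incl-⊢tm t) (incl-⊢tm u)
incl-⊢tm (G.var w m) = var (incl-⊢ w) (incl-∈ m)

incl-⊢s : ∀ {Δ σ Γ} → Δ G.⊢s σ ∶ Γ → inclCtx Δ ⊢s inclSub σ ∶ inclCtx Γ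
incl-⊢s (G.⟨⟩-wf w) = ⟨⟩-wf (incl-⊢ w)
incl-⊢s (G.ext-wf {Δ} {σ = σ} {A = A} {t} d w tm) =
  ext-wf (incl-⊢s d) (incl-⊢ w) (subst (λ B → inclCtx Δ ⊢ var t ∶ B) (incl-[]T A σ) (incl-⊢tm tm))

eraseTy-inclTy : ∀ A → eraseTy (inclTy A) ≡ A
eraseTy-inclTy G.⋆ = refl
eraseTy-inclTy (G.Hom G.⋆ t u) = refl
eraseTy-inclTy (G.Hom (G.Hom A a b) t u) = cong (λ B → G.Hom B t u) (eraseTy-inclTy (G.Hom A a b))

eraseCtx-inclCtx : ∀ Γ → eraseCtx (inclCtx Γ) ≡ Γ
eraseCtx-inclCtx G.∅ = refl
eraseCtx-inclCtx (Γ G.▸ x ∶ G.⋆) = cong (G._▸ x ∶ G.⋆) (eraseCtx-inclCtx Γ)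
eraseCtx-inclCtx (Γ G.▸ x ∶ G.Hom A t u) =
  cong₂ (G._▸ x ∶_) (eraseCtx-inclCtx Γ) (eraseTy-inclTy (G.Hom A t u))

eraseSub-inclSub : ∀ {Δ σ Γ} → Δ G.⊢s σ ∶ Γ → eraseSub (inclCtx Γ) (inclSub σ) ≡ σ
eraseSub-inclSub (G.⟨⟩-wf _) = refl
eraseSub-inclSub (G.ext-wf {x = x} {A = G.⋆} {t} d _ _) = cong (G._, x ↦ t) (eraseSub-inclSub d)
eraseSub-inclSub (G.ext-wf {x = x} {A = G.Hom _ _ _} {t} d _ _) = cong (G._, x ↦ t) (eraseSub-inclSub d)

IsHom : Ty → Set
IsHom 𝟏 = ⊥
IsHom (Hom _ _ _) = ⊤

shape : Ty → Maybe G.Ty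
shape 𝟏 = nothing
shape (Hom A t u) = just (eraseTy (Hom A t u))

shape≡nothing⇒≡𝟏 : ∀ {A} → shape A ≡ nothing → A ≡ 𝟏
shape≡nothing⇒≡𝟏 {𝟏} _ = refl

shape-IsHom : ∀ {A B} → shape A ≡ shape B → IsHom B → IsHom A
shape-IsHom {𝟏} {𝟏} _ ()
shape-IsHom {𝟏} {Hom _ _ _} () _
shape-IsHom {Hom _ _ _} _ _ = tt

shape⇒eraseTy≡ : ∀ {A B} → shape A ≡ shape B → IsHom B → eraseTy A ≡ eraseTy B
shape⇒eraseTy≡ {_} {𝟏} _ ()
shape⇒eraseTy≡ {𝟏} {Hom _ _ _} () _
shape⇒eraseTy≡ {Hom _ _ _} {Hom _ _ _} e _ = just-injective e

shape-Hom-cong : ∀ {A A′ t t′ u u′} → shape A ≡ shape A′ →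
                 (IsHom A → t ≡ t′) → (IsHom A → u ≡ u′) →
                 shape (Hom A t u) ≡ shape (Hom A′ t′ u′)
shape-Hom-cong {𝟏} {𝟏} _ _ _ = refl
shape-Hom-cong {Hom _ _ _} {Hom _ _ _} e t≡t′ u≡u′
  rewrite just-injective e | t≡t′ tt | u≡u′ tt = refl

≡ty⇒shape≡ : ∀ {Γ A B} → Γ ⊢ A ≡ty B → shape A ≡ shape B
≡tm⇒≡ : ∀ {Γ t u A} → Γ ⊢ t ≡tm u ∶ A → IsHom A → t ≡ u
≡ty⇒shape≡ (ty-refl _) = refl
≡ty⇒shape≡ (ty-sym e) = sym (≡ty⇒shape≡ e)
≡ty⇒shape≡ (ty-trans e f) = trans (≡ty⇒shape≡ e) (≡ty⇒shape≡ f)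
≡ty⇒shape≡ (Hom-cong e f g) = shape-Hom-cong (≡ty⇒shape≡ e) (≡tm⇒≡ f) (≡tm⇒≡ g)
≡tm⇒≡ (tm-refl _) _ = refl
≡tm⇒≡ (tm-sym e) h = sym (≡tm⇒≡ e h)
≡tm⇒≡ (tm-trans e f) h = trans (≡tm⇒≡ e h) (≡tm⇒≡ f h)
≡tm⇒≡ (tm-conv e f) h = ≡tm⇒≡ e (shape-IsHom (≡ty⇒shape≡ f) h)

data VarOfShape (Γ : Ctx) : Tm → Ty → Set where
  var : ∀ {y A B} → y ∶ B ∈ Γ → shape B ≡ shape A → VarOfShape Γ (var y) A

canonical : ∀ {Γ t A} → Γ ⊢ t ∶ A → (t ≡ ⋆tt × A ≡ 𝟏) ⊎ VarOfShape Γ t A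
canonical (var _ m) = inj₂ (var m refl)
canonical (tt-wf _) = inj₁ (refl , refl)
canonical (conv d e) with canonical d
... | inj₁ (t≡⋆tt , refl) = inj₁ (t≡⋆tt , shape≡nothing⇒≡𝟏 (sym (≡ty⇒shape≡ e)))
... | inj₂ (var m s) = inj₂ (var m (trans s (≡ty⇒shape≡ e)))

canonical-Hom : ∀ {Γ t A} → Γ ⊢ t ∶ A → IsHom A → VarOfShape Γ t A
canonical-Hom d h with canonical d
... | inj₁ (_ , refl) = ⊥-elim h
... | inj₂ v = v

var-eraseTm : ∀ {Γ t A} → Γ ⊢ t ∶ A → IsHom A → var (eraseTm t) ≡ t
var-eraseTm d h with canonical-Hom d h
... | var _ _ = refl

≡ty-inclTy-eraseTy : ∀ {Γ A} → Γ ⊢ty A → IsHom A → Γ ⊢ A ≡ty inclTy (eraseTy A)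
≡ty-inclTy-eraseTy (Hom-wf a@(𝟏-wf _) ta tb) _ = Hom-cong (ty-refl a) (𝟏-η ta) (𝟏-η tb)
≡ty-inclTy-eraseTy (Hom-wf {A = Hom _ _ _} a ta tb) _
  with canonical-Hom ta tt | canonical-Hom tb tt
... | var _ _ | var _ _ = Hom-cong (≡ty-inclTy-eraseTy a tt) (tm-refl ta) (tm-refl tb)

erase-fresh : ∀ {x Γ} → Fresh x Γ → G.Fresh x (eraseCtx Γ)
erase-fresh {Γ = ∅} _ = tt
erase-fresh {Γ = Γ ▸ y ∶ 𝟏} (_ , fr) = erase-fresh fr
erase-fresh {Γ = Γ ▸ y ∶ Hom _ _ _} (x≢y , fr) = x≢y , erase-fresh fr

erase-∈ : ∀ {x A Γ} → x ∶ A ∈ Γ → IsHom A → x G.∶ eraseTy A ∈ eraseCtx Γ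
erase-∈ {A = Hom _ _ _} here _ = G.here
erase-∈ (there {B = 𝟏} m) h = erase-∈ m h
erase-∈ (there {B = Hom _ _ _} m) h = G.there (erase-∈ m h)

erase-⊢ : ∀ {Γ} → Γ ⊢ → eraseCtx Γ G.⊢
erase-⊢ty : ∀ {Γ A} → Γ ⊢ty A → IsHom A → eraseCtx Γ G.⊢ty eraseTy A
erase-⊢tm : ∀ {Γ t A} → Γ ⊢ t ∶ A → IsHom A → eraseCtx Γ G.⊢ eraseTm t ∶ eraseTy A
erase-⊢ ∅-wf = G.∅-wf
erase-⊢ (▸-wf (𝟏-wf w) _) = erase-⊢ w
erase-⊢ (▸-wf a@(Hom-wf _ _ _) fr) = G.▸-wf (erase-⊢ty a tt) (erase-fresh fr)
erase-⊢ty (Hom-wf (𝟏-wf w) _ _) _ = G.⋆-wf (erase-⊢ w)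
erase-⊢ty (Hom-wf (Hom-wf _ _ _) t u) _ = G.Hom-wf (erase-⊢tm t tt) (erase-⊢tm u tt)
erase-⊢tm (var w m) h = G.var (erase-⊢ w) (erase-∈ m h)
erase-⊢tm (conv d e) h =
  subst (λ X → _ G.⊢ _ ∶ X) (shape⇒eraseTy≡ (≡ty⇒shape≡ e) h)
    (erase-⊢tm d (shape-IsHom (≡ty⇒shape≡ e) h))

erase-[]v : ∀ {Θ δ Δ y B} → Θ ⊢s δ ∶ Δ → y ∶ B ∈ Δ → IsHom B →
            eraseTm (y [ δ ]v) ≡ y G.[ eraseSub Δ δ ]v
erase-[]v (ext-wf {x = z} {A = Hom _ _ _} d w s) here _ rewrite ≡ᵇ-refl z = refl
erase-[]v (ext-wf {A = 𝟏} d (▸-wf _ fr) s) (there m) h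
  rewrite ≡ᵇ-≢ (∈-fresh⇒≢ fr m) = erase-[]v d m h
erase-[]v (ext-wf {A = Hom _ _ _} d (▸-wf _ fr) s) (there m) h
  rewrite ≡ᵇ-≢ (∈-fresh⇒≢ fr m) = erase-[]v d m h

erase-[]t : ∀ {Θ δ Δ a A} → Δ ⊢ a ∶ A → IsHom A → Θ ⊢s δ ∶ Δ →
            eraseTm (a [ δ ]t) ≡ eraseTm a G.[ eraseSub Δ δ ]v
erase-[]t ta h d with canonical-Hom ta h
... | var m s = erase-[]v d m (shape-IsHom s h)

erase-[]T : ∀ {Γ A Δ σ} → Γ ⊢ty A → IsHom A → Δ ⊢s σ ∶ Γ →
            eraseTy (A [ σ ]T) ≡ eraseTy A G.[ eraseSub Γ σ ]T
erase-[]T (Hom-wf (𝟏-wf _) _ _) _ d = refl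
erase-[]T (Hom-wf {A = Hom _ _ _} a ta tb) _ d
  rewrite erase-[]T a tt d | erase-[]t ta tt d | erase-[]t tb tt d = refl

erase-⊢s : ∀ {Δ σ Γ} → Δ ⊢s σ ∶ Γ → eraseCtx Δ G.⊢s eraseSub Γ σ ∶ eraseCtx Γ
erase-⊢s (⟨⟩-wf w) = G.⟨⟩-wf (erase-⊢ w)
erase-⊢s (ext-wf {A = 𝟏} d _ _) = erase-⊢s d
erase-⊢s (ext-wf {Δ} {A = Hom _ _ _} {t} d w@(▸-wf a _) tm) =
  G.ext-wf (erase-⊢s d) (erase-⊢ w)
    (subst (λ X → eraseCtx Δ G.⊢ eraseTm t ∶ X) (erase-[]T a tt d) (erase-⊢tm tm tt))

erase-idS : ∀ Γ → eraseSub Γ (idS Γ) ≡ G.idS (eraseCtx Γ)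
erase-idS ∅ = refl
erase-idS (Γ ▸ x ∶ 𝟏) = erase-idS Γ
erase-idS (Γ ▸ x ∶ Hom A a b) = cong (G._, x ↦ x) (erase-idS Γ)

erase-∘ : ∀ {Θ δ Δ σ Γ} → Δ ⊢s σ ∶ Γ → Θ ⊢s δ ∶ Δ →
          eraseSub Γ (σ ∘ δ) ≡ eraseSub Γ σ G.∘ eraseSub Δ δ
erase-∘ (⟨⟩-wf _) _ = refl
erase-∘ (ext-wf {A = 𝟏} d _ _) dδ = erase-∘ d dδ
erase-∘ (ext-wf {x = x} {A = Hom _ _ _} d _ tm) dδ =
  cong₂ (G._, x ↦_) (erase-∘ d dδ) (erase-[]t tm tt dδ)

erase-resp-≡s : ∀ {Δ σ τ Γ} → Δ ⊢s σ ≡s τ ∶ Γ → eraseSub Γ σ ≡ eraseSub Γ τ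
erase-resp-≡s (⟨⟩-eq _) = refl
erase-resp-≡s (ext-eq {A = 𝟏} e _ _) = erase-resp-≡s e
erase-resp-≡s (ext-eq {x = x} {A = Hom _ _ _} e _ te) =
  cong₂ (G._, x ↦_) (erase-resp-≡s e) (cong eraseTm (≡tm⇒≡ te tt))

erase-reflects-≡s : ∀ {Δ σ τ Γ} → Δ ⊢s σ ∶ Γ → Δ ⊢s τ ∶ Γ →
                    eraseSub Γ σ ≡ eraseSub Γ τ → Δ ⊢s σ ≡s τ ∶ Γ
erase-reflects-≡s (⟨⟩-wf w) (⟨⟩-wf _) _ = ⟨⟩-eq w
erase-reflects-≡s (ext-wf {A = 𝟏} d w t) (ext-wf d′ _ u) e =
  ext-eq (erase-reflects-≡s d d′ e) w (tm-trans (𝟏-η t) (tm-sym (𝟏-η u)))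
erase-reflects-≡s (ext-wf {A = Hom _ _ _} d w t) (ext-wf d′ _ u) e
  with canonical-Hom t tt | canonical-Hom u tt | ,↦-injective e
... | var _ _ | var _ _ | e′ , refl = ext-eq (erase-reflects-≡s d d′ e′) w (tm-refl t)

norm : Ctx → Sub → Sub
norm ∅ σ = ⟨⟩
norm (Γ ▸ x ∶ A) ⟨⟩ = ⟨⟩
norm (Γ ▸ x ∶ 𝟏) (σ , y ↦ t) = norm Γ σ , y ↦ ⋆tt
norm (Γ ▸ x ∶ Hom A a b) (σ , y ↦ t) = norm Γ σ , y ↦ t

collapse : Ctx → Sub
collapse Γ = norm Γ (idS Γ)

restrict : Ctx → Sub
restrict Γ = inclSub (eraseSub Γ (idS Γ))

norm-[]v-𝟏 : ∀ {Δ σ Γ y} → Δ ⊢s σ ∶ Γ → y ∶ 𝟏 ∈ Γ → y [ norm Γ σ ]v ≡ ⋆tt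
norm-[]v-𝟏 (ext-wf {x = z} {A = 𝟏} d w s) here rewrite ≡ᵇ-refl z = refl
norm-[]v-𝟏 (ext-wf {A = 𝟏} d (▸-wf _ fr) s) (there m)
  rewrite ≡ᵇ-≢ (∈-fresh⇒≢ fr m) = norm-[]v-𝟏 d m
norm-[]v-𝟏 (ext-wf {A = Hom _ _ _} d (▸-wf _ fr) s) (there m)
  rewrite ≡ᵇ-≢ (∈-fresh⇒≢ fr m) = norm-[]v-𝟏 d m

norm-[]v-Hom : ∀ {Δ σ Γ y B} → Δ ⊢s σ ∶ Γ → y ∶ B ∈ Γ → IsHom B → y [ norm Γ σ ]v ≡ y [ σ ]v
norm-[]v-Hom (ext-wf {x = z} {A = Hom _ _ _} d w s) here _ rewrite ≡ᵇ-refl z = refl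
norm-[]v-Hom (ext-wf {A = 𝟏} d (▸-wf _ fr) s) (there m) h
  rewrite ≡ᵇ-≢ (∈-fresh⇒≢ fr m) = norm-[]v-Hom d m h
norm-[]v-Hom (ext-wf {A = Hom _ _ _} d (▸-wf _ fr) s) (there m) h
  rewrite ≡ᵇ-≢ (∈-fresh⇒≢ fr m) = norm-[]v-Hom d m h

[]v-Hom-var : ∀ {Δ σ Γ y B} → Δ ⊢s σ ∶ Γ → y ∶ B ∈ Γ → IsHom B →
              var (eraseTm (y [ σ ]v)) ≡ y [ σ ]v
[]v-Hom-var (ext-wf {x = z} {A = Hom _ _ _} d w s) here _ rewrite ≡ᵇ-refl z = var-eraseTm s tt
[]v-Hom-var (ext-wf d (▸-wf _ fr) s) (there m) h
  rewrite ≡ᵇ-≢ (∈-fresh⇒≢ fr m) = []v-Hom-var d m h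

norm-[]t-𝟏 : ∀ {Γ a Δ σ} → Γ ⊢ a ∶ 𝟏 → Δ ⊢s σ ∶ Γ → a [ norm Γ σ ]t ≡ ⋆tt
norm-[]t-𝟏 ta d with canonical ta
... | inj₁ (refl , _) = refl
... | inj₂ (var m s) = norm-[]v-𝟏 d (subst (λ X → _ ∶ X ∈ _) (shape≡nothing⇒≡𝟏 s) m)

norm-[]t-Hom : ∀ {Γ a A Δ σ} → Γ ⊢ a ∶ A → IsHom A → Δ ⊢s σ ∶ Γ →
               a [ norm Γ σ ]t ≡ var (eraseTm (a [ σ ]t))
norm-[]t-Hom ta h d with canonical-Hom ta h
... | var m s = trans (norm-[]v-Hom d m h′) (sym ([]v-Hom-var d m h′))
  where h′ = shape-IsHom s h

norm-[]T : ∀ {Γ A Δ σ} → Γ ⊢ty A → IsHom A → Δ ⊢s σ ∶ Γ →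
           A [ norm Γ σ ]T ≡ inclTy (eraseTy (A [ σ ]T))
norm-[]T (Hom-wf (𝟏-wf _) ta tb) _ d rewrite norm-[]t-𝟏 ta d | norm-[]t-𝟏 tb d = refl
norm-[]T (Hom-wf {A = Hom _ _ _} a ta tb) _ d
  rewrite norm-[]T a tt d | norm-[]t-Hom ta tt d | norm-[]t-Hom tb tt d = refl

Retyping : Ctx → Ctx → Set
Retyping Δ Δ′ = ∀ {t A} → Δ ⊢ t ∶ A → IsHom A → Δ′ ⊢ var (eraseTm t) ∶ inclTy (eraseTy A)

retyping-refl : ∀ {Δ} → Retyping Δ Δ
retyping-refl {Δ} ta h with canonical-Hom ta h
... | var m s =
  subst (λ X → Δ ⊢ _ ∶ inclTy X) (shape⇒eraseTy≡ s h)
    (conv (var w m) (≡ty-inclTy-eraseTy (∈⇒⊢ty w m) (shape-IsHom s h)))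
  where w = ⊢tm⇒⊢ ta

retyping-erase : ∀ {Δ} → Retyping Δ (inclCtx (eraseCtx Δ))
retyping-erase ta h = incl-⊢tm (erase-⊢tm ta h)

norm-⊢s : ∀ {Δ Δ′ σ Γ} → Retyping Δ Δ′ → Δ′ ⊢ → Δ ⊢s σ ∶ Γ → Δ′ ⊢s norm Γ σ ∶ Γ
norm-⊢s r w′ (⟨⟩-wf _) = ⟨⟩-wf w′
norm-⊢s r w′ (ext-wf {A = 𝟏} d w _) = ext-wf (norm-⊢s r w′ d) w (tt-wf w′)
norm-⊢s {Δ′ = Δ′} r w′ (ext-wf {A = Hom _ _ _} {t} d w@(▸-wf a _) tm) =
  ext-wf (norm-⊢s r w′ d) w
    (subst₂ (λ s X → Δ′ ⊢ s ∶ X) (var-eraseTm tm tt) (sym (norm-[]T a tt d)) (r tm tt))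

inclErase-⊢s : ∀ {Δ Δ′ σ Γ} → Retyping Δ Δ′ → Δ′ ⊢ → Δ ⊢s σ ∶ Γ →
               Δ′ ⊢s inclSub (eraseSub Γ σ) ∶ inclCtx (eraseCtx Γ)
inclErase-⊢s r w′ (⟨⟩-wf _) = ⟨⟩-wf w′
inclErase-⊢s r w′ (ext-wf {A = 𝟏} d _ _) = inclErase-⊢s r w′ d
inclErase-⊢s {Δ′ = Δ′} r w′ (ext-wf {Γ = Γ} {σ} {A = A@(Hom _ _ _)} {t} d w@(▸-wf a _) tm) =
  ext-wf (inclErase-⊢s r w′ d) (incl-⊢ (erase-⊢ w))
    (subst (λ X → Δ′ ⊢ var (eraseTm t) ∶ X)
       (trans (cong inclTy (erase-[]T a tt d)) (incl-[]T (eraseTy A) (eraseSub Γ σ)))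
       (r tm tt))

eraseSub-norm : ∀ Γ σ → eraseSub Γ (norm Γ σ) ≡ eraseSub Γ σ
eraseSub-norm ∅ σ = refl
eraseSub-norm (Γ ▸ x ∶ A) ⟨⟩ = refl
eraseSub-norm (Γ ▸ x ∶ 𝟏) (σ , y ↦ t) = eraseSub-norm Γ σ
eraseSub-norm (Γ ▸ x ∶ Hom A a b) (σ , y ↦ t) = cong (G._, y ↦ eraseTm t) (eraseSub-norm Γ σ)

norm-inclCtx : ∀ Γ {Δ σ} → Δ ⊢s σ ∶ inclCtx Γ → norm (inclCtx Γ) σ ≡ σ
norm-inclCtx G.∅ (⟨⟩-wf _) = refl
norm-inclCtx (Γ G.▸ x ∶ G.⋆) (ext-wf d _ _) = cong (_, x ↦ _) (norm-inclCtx Γ d)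
norm-inclCtx (Γ G.▸ x ∶ G.Hom _ _ _) (ext-wf d _ _) = cong (_, x ↦ _) (norm-inclCtx Γ d)

∘-collapse : ∀ {Δ σ Γ} → Δ ⊢ → Δ ⊢s σ ∶ Γ → σ ∘ collapse Δ ≡ norm Γ σ
∘-collapse wΔ (⟨⟩-wf _) = refl
∘-collapse wΔ (ext-wf {x = x} {A = 𝟏} d _ tm) =
  cong₂ (_, x ↦_) (∘-collapse wΔ d) (norm-[]t-𝟏 tm (idS-wf wΔ))
∘-collapse {Δ} wΔ (ext-wf {x = x} {A = Hom _ _ _} {t} d _ tm) =
  cong₂ (_, x ↦_) (∘-collapse wΔ d) (begin
    t [ collapse Δ ]t              ≡⟨ norm-[]t-Hom tm tt (idS-wf wΔ) ⟩
    var (eraseTm (t [ idS Δ ]t))   ≡⟨ cong (var ∘′ eraseTm) ([]t-idS Δ t) ⟩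
    var (eraseTm t)                ≡⟨ var-eraseTm tm tt ⟩
    t                              ∎)
  where open ≡-Reasoning

collapse-∘-fresh : ∀ {x Γ τ s} → Fresh x Γ → collapse Γ ∘ (τ , x ↦ s) ≡ collapse Γ ∘ τ
collapse-∘-fresh {Γ = ∅} _ = refl
collapse-∘-fresh {Γ = Γ ▸ y ∶ 𝟏} (_ , fr) = cong (_, y ↦ ⋆tt) (collapse-∘-fresh fr)
collapse-∘-fresh {x} {Γ ▸ y ∶ Hom _ _ _} {τ} (x≢y , fr) rewrite ≡ᵇ-≢ (x≢y ∘′ sym) =
  cong (_, y ↦ (y [ τ ]v)) (collapse-∘-fresh fr)

collapse-∘-inclErase : ∀ {Δ σ Γ} → Δ ⊢s σ ∶ Γ → collapse Γ ∘ inclSub (eraseSub Γ σ) ≡ norm Γ σ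
collapse-∘-inclErase (⟨⟩-wf _) = refl
collapse-∘-inclErase (ext-wf {x = x} {A = 𝟏} d _ _) = cong (_, x ↦ ⋆tt) (collapse-∘-inclErase d)
collapse-∘-inclErase (ext-wf {Γ = Γ} {σ} {x} {Hom _ _ _} {t} d (▸-wf _ fr) tm)
  rewrite collapse-∘-fresh {τ = inclSub (eraseSub Γ σ)} {s = var (eraseTm t)} fr | ≡ᵇ-refl x =
  cong₂ (_, x ↦_) (collapse-∘-inclErase d) (var-eraseTm tm tt)

collapse-≡s-idS : ∀ {Γ} → Γ ⊢ → Γ ⊢s collapse Γ ≡s idS Γ ∶ Γ
collapse-≡s-idS {Γ} w =
  erase-reflects-≡s (norm-⊢s retyping-refl w (idS-wf w)) (idS-wf w) (eraseSub-norm Γ (idS Γ))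

collapse-⊢s : ∀ {Γ} → Γ ⊢ → inclCtx (eraseCtx Γ) ⊢s collapse Γ ∶ Γ
collapse-⊢s w = norm-⊢s retyping-erase (incl-⊢ (erase-⊢ w)) (idS-wf w)

restrict-⊢s : ∀ {Γ} → Γ ⊢ → Γ ⊢s restrict Γ ∶ inclCtx (eraseCtx Γ)
restrict-⊢s w = inclErase-⊢s retyping-refl w (idS-wf w)

restrict-∘-collapse : ∀ {Γ} → Γ ⊢ → restrict Γ ∘ collapse Γ ≡ idS (inclCtx (eraseCtx Γ))
restrict-∘-collapse {Γ} w = begin
  restrict Γ ∘ collapse Γ                   ≡⟨ ∘-collapse w (restrict-⊢s w) ⟩
  norm (inclCtx (eraseCtx Γ)) (restrict Γ)  ≡⟨ norm-inclCtx (eraseCtx Γ) (restrict-⊢s w) ⟩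
  restrict Γ                                ≡⟨ cong inclSub (erase-idS Γ) ⟩
  inclSub (G.idS (eraseCtx Γ))              ≡⟨ incl-idS (eraseCtx Γ) ⟩
  idS (inclCtx (eraseCtx Γ))                ∎
  where open ≡-Reasoning

incl : FunData Glob.theory Glob₁.theory
incl = record
  { F₀ = λ (Γ , w) → inclCtx Γ , incl-⊢ w
  ; F₁ = λ (σ , d) → inclSub σ , incl-⊢s d
  }

erase : FunData Glob₁.theory Glob.theory
erase = record
  { F₀ = λ (Γ , w) → eraseCtx Γ , erase-⊢ w
  ; F₁ = λ {_} {Γ} (σ , d) → eraseSub (proj₁ Γ) σ , erase-⊢s d
  }

incl-isFunctor : IsFunctor incl
incl-isFunctor = record
  { F-resp = λ { (_ , d) _ refl → ≡s-refl (incl-⊢s d) }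
  ; F-id   = λ (Γ , _) d → ≡s-resp-≡ refl (incl-idS Γ) (≡s-refl (incl-⊢s d))
  ; F-comp = λ (σ , _) (δ , _) d → ≡s-resp-≡ refl (incl-∘ σ δ) (≡s-refl (incl-⊢s d))
  }

erase-isFunctor : IsFunctor erase
erase-isFunctor = record
  { F-resp = λ _ _ → erase-resp-≡s
  ; F-id   = λ (Γ , _) _ → erase-idS Γ
  ; F-comp = λ (_ , d) (_ , dδ) _ → erase-∘ d dδ
  }

unit : NatIso (idFun Glob.theory) (erase ∘F incl)
unit = record
  { η       = λ (Γ , w) → G.idS Γ ,
      subst (λ Γ′ → Γ G.⊢s G.idS Γ ∶ Γ′) (sym (eraseCtx-inclCtx Γ)) (G.idS-wf w)
  ; η⁻¹     = λ (Γ , w) → G.idS Γ ,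
      subst (λ Γ′ → Γ′ G.⊢s G.idS Γ ∶ Γ) (sym (eraseCtx-inclCtx Γ)) (G.idS-wf w)
  ; iso₁    = λ (Γ , _) → G.∘-identityʳ (G.idS Γ) Γ
  ; iso₂    = λ (Γ , _) →
      trans (G.∘-identityʳ (G.idS Γ) Γ) (cong G.idS (sym (eraseCtx-inclCtx Γ)))
  ; natural = λ {(Δ , _)} (σ , d) →
      trans (G.∘-identityʳ _ Δ) (trans (eraseSub-inclSub d) (sym (G.∘-identityˡ d)))
  }

counit : NatIso (incl ∘F erase) (idFun Glob₁.theory)
counit = record
  { η       = λ (Γ , w) → collapse Γ , collapse-⊢s w
  ; η⁻¹     = λ (Γ , w) → restrict Γ , restrict-⊢s w
  ; iso₁    = λ (Γ , w) →
      ≡s-resp-≡ (sym (restrict-∘-collapse w)) refl (≡s-refl (idS-wf (incl-⊢ (erase-⊢ w))))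
  ; iso₂    = λ (Γ , w) →
      ≡s-resp-≡ (sym (collapse-∘-inclErase (idS-wf w))) refl (collapse-≡s-idS w)
  ; natural = λ {(Δ , w)} (σ , d) →
      ≡s-resp-≡ (sym (∘-collapse w d)) (sym (collapse-∘-inclErase d))
        (≡s-refl (norm-⊢s retyping-erase (incl-⊢ (erase-⊢ w)) d))
  }

mainTheorem5 : SynEquivalence Glob.theory Glob₁.theory
mainTheorem5 = record
  { F       = incl
  ; G       = erase
  ; F-isFun = incl-isFunctor
  ; G-isFun = erase-isFunctor
  ; unit    = unit
  ; counit  = counit
  }
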